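{- Let $r$ be a complex number and let $m,n\ge0$ be integers. Then, as polynomials in $x$, $$D_m^{(r)}(x)D_n^{(r)}(x)=\sum_{k=0}^{\min\{m,n\}}\binom{m}{k}\binom{n}{k}k!^2\binom{2r+m+n-k}{k} D_{m+n-2k}^{(r)}(x).$$
   Context: For a complex number $a$ and integer $k\ge0$, $\binom{a}{k}=a(a-1)\cdots(a-k+1)/k!$. For a parameter $r$, the polynomials $D_n^{(r)}(x)$ are defined by $D_{ -1}^{(r)}(x)=0$, $D_0^{(r)}(x)=1$ and $D_{n+1}^{(r)}(x)=xD_n^{(r)}(x)-n(n+2r)D_{n-1}^{(r)}(x)$ for $n\ge0$. -}

module Defs where

open import Data.Nat using (ℕ; zero; suc)
open import Algebra.Bundles using (CommutativeRing)

module _ {c ℓ} (R : CommutativeRing c ℓ) where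
  open CommutativeRing R hiding (zero)

  ι : ℕ → Carrier
  ι zero    = 0#
  ι (suc n) = 1# + ι n

  -- falling factorial a (a-1) ... (a-k+1) ; equals binom(a,k) * k!
  ff : Carrier → ℕ → Carrier
  ff a zero    = 1#
  ff a (suc k) = ff a k * (a - ι k)

  -- D r n x = D_n^{(r)}(x), via D_{-1}=0, D_0=1,
  -- D_{n+1} = x D_n - n(n+2r) D_{n-1}
  D : Carrier → ℕ → Carrier → Carrier
  D r zero x          = 1#
  D r (suc zero) x    = x * 1# - (0# * 0#)
  D r (suc (suc n)) x =
    x * D r (suc n) x - (ι (suc n) * (ι (suc n) + (r + r))) * D r n x

  sumTo : ℕ → (ℕ → Carrier) → Carrier
  sumTo zero    f = f zero
  sumTo (suc N) f = sumTo N f + f (suc N)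

{-# OPTIONS --safe #-}
module Submission where

-- Induction on m along D_{m+2} = x D_{m+1} - (m+1)(m+1+2r) D_m, rewriting each x D_i in the
-- expansions of D_{m+1} D_n and D_m D_n as D_{i+1} + i(i+2r) D_{i-1}. With the k-th coefficient
-- written as C(m,k) (n)_k (2r+m+n-k)_k in falling factorials, comparing the coefficients of
-- D_{m+n+2-2k} reduces to a three-term recurrence for these coefficients, which follows from
-- Pascal's rule and the absorption identities (m+1) C(m,k) = (k+1) C(m+1,k+1) and
-- (k+1) C(m,k+1) + k C(m,k) = m C(m,k). No division occurs, so this works in any commutative ring.

open import Defs
open import Data.Nat using (ℕ; _⊓_; _∸_; _!) renaming (_+_ to _+ℕ_; _*_ to _*ℕ_)
open import Data.Nat.Combinatorics using (_C_)
open import Algebra.Bundles using (CommutativeRing)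

open import Data.Nat.Base as ℕ using (zero; suc; _≤_; _<_; s≤s; z≤n)
import Data.Nat.Properties as ℕ
open import Data.Nat.Combinatorics using (nC1≡n; k>n⇒nCk≡0; nCk+nC[k+1]≡[n+1]C[k+1])
open import Data.Nat.Tactic.RingSolver using (solve-∀)
open import Data.Integer.Base as ℤ using (ℤ; +_; -[1+_])
import Data.Integer.Properties as ℤ
open import Data.Sign.Base as Sign using (Sign)
open import Data.Maybe.Base using (Maybe; just; nothing)
open import Data.Product.Base using (_,_; proj₁)
open import Data.Sum.Base as Sum using (_⊎_; inj₁; inj₂; [_,_]′)
open import Function.Base using (_∘_; id)
open import Relation.Nullary.Decidable using (yes; no)
open import Relation.Binary.PropositionalEquality as ≡ using (_≡_)
import Algebra.Solver.Ring.AlmostCommutativeRing as ACR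

[1+n]*nCk≡[1+k]*[1+n]C[1+k] : ∀ n k → suc n *ℕ (n C k) ≡ suc k *ℕ (suc n C suc k)
[1+n]*nCk≡[1+k]*[1+n]C[1+k] zero    zero    = ≡.refl
[1+n]*nCk≡[1+k]*[1+n]C[1+k] zero    (suc k) = ≡.sym (ℕ.*-zeroʳ (suc (suc k)))
[1+n]*nCk≡[1+k]*[1+n]C[1+k] (suc n) zero    =
  ≡.trans (ℕ.*-identityʳ (suc (suc n))) (≡.sym (≡.trans (ℕ.+-identityʳ _) (nC1≡n (suc (suc n)))))
[1+n]*nCk≡[1+k]*[1+n]C[1+k] (suc n) (suc k) = begin
  suc (suc n) *ℕ (suc n C suc k)                            ≡⟨ ≡.cong (suc (suc n) *ℕ_) (pascal n k) ⟨
  suc (suc n) *ℕ (n C k +ℕ n C suc k)                        ≡⟨ distrib n (n C k) (n C suc k) ⟩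
  suc n *ℕ (n C k) +ℕ suc n *ℕ (n C suc k) +ℕ (n C k +ℕ n C suc k)
    ≡⟨ ≡.cong₂ (λ u v → u +ℕ v +ℕ (n C k +ℕ n C suc k))
         ([1+n]*nCk≡[1+k]*[1+n]C[1+k] n k) ([1+n]*nCk≡[1+k]*[1+n]C[1+k] n (suc k)) ⟩
  suc k *ℕ (suc n C suc k) +ℕ suc (suc k) *ℕ (suc n C suc (suc k)) +ℕ (n C k +ℕ n C suc k)
    ≡⟨ ≡.cong (suc k *ℕ (suc n C suc k) +ℕ suc (suc k) *ℕ (suc n C suc (suc k)) +ℕ_) (pascal n k) ⟩
  suc k *ℕ (suc n C suc k) +ℕ suc (suc k) *ℕ (suc n C suc (suc k)) +ℕ suc n C suc k
    ≡⟨ collect k (suc n C suc k) (suc n C suc (suc k)) ⟩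
  suc (suc k) *ℕ (suc n C suc k +ℕ suc n C suc (suc k))
    ≡⟨ ≡.cong (suc (suc k) *ℕ_) (pascal (suc n) (suc k)) ⟩
  suc (suc k) *ℕ (suc (suc n) C suc (suc k))                ∎
  where
  open ≡.≡-Reasoning
  pascal = nCk+nC[k+1]≡[n+1]C[k+1]
  distrib : ∀ n a b → suc (suc n) *ℕ (a +ℕ b) ≡ suc n *ℕ a +ℕ suc n *ℕ b +ℕ (a +ℕ b)
  distrib = solve-∀
  collect : ∀ k c d → suc k *ℕ c +ℕ suc (suc k) *ℕ d +ℕ c ≡ suc (suc k) *ℕ (c +ℕ d)
  collect = solve-∀

[1+k]*nC[1+k]+k*nCk≡n*nCk : ∀ n k → suc k *ℕ (n C suc k) +ℕ k *ℕ (n C k) ≡ n *ℕ (n C k)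
[1+k]*nC[1+k]+k*nCk≡n*nCk zero    zero    = ≡.refl
[1+k]*nC[1+k]+k*nCk≡n*nCk zero    (suc k) = ≡.cong₂ _+ℕ_ (ℕ.*-zeroʳ (suc (suc k))) (ℕ.*-zeroʳ (suc k))
[1+k]*nC[1+k]+k*nCk≡n*nCk (suc n) zero    =
  ≡.trans (ℕ.+-identityʳ _) (≡.sym ([1+n]*nCk≡[1+k]*[1+n]C[1+k] n zero))
[1+k]*nC[1+k]+k*nCk≡n*nCk (suc n) (suc k) = begin
  suc (suc k) *ℕ (suc n C suc (suc k)) +ℕ suc k *ℕ (suc n C suc k)
    ≡⟨ ≡.cong₂ _+ℕ_ ([1+n]*nCk≡[1+k]*[1+n]C[1+k] n (suc k)) ([1+n]*nCk≡[1+k]*[1+n]C[1+k] n k) ⟨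
  suc n *ℕ (n C suc k) +ℕ suc n *ℕ (n C k)    ≡⟨ ℕ.+-comm (suc n *ℕ (n C suc k)) _ ⟩
  suc n *ℕ (n C k) +ℕ suc n *ℕ (n C suc k)    ≡⟨ ℕ.*-distribˡ-+ (suc n) (n C k) (n C suc k) ⟨
  suc n *ℕ (n C k +ℕ n C suc k)               ≡⟨ ≡.cong (suc n *ℕ_) (nCk+nC[k+1]≡[n+1]C[k+1] n k) ⟩
  suc n *ℕ (suc n C suc k)                    ∎
  where open ≡.≡-Reasoning

k≤m⇒k≤n⇒2k≤m+n : ∀ {k m n} → k ≤ m → k ≤ n → 2 *ℕ k ≤ m +ℕ n
k≤m⇒k≤n⇒2k≤m+n {k} k≤m k≤n =
  ℕ.+-mono-≤ k≤m (ℕ.≤-trans (ℕ.≤-reflexive (ℕ.+-identityʳ k)) k≤n)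

[2+a]∸2[1+k]≡a∸2k : ∀ a k → suc (suc a) ∸ 2 *ℕ suc k ≡ a ∸ 2 *ℕ k
[2+a]∸2[1+k]≡a∸2k a k = ≡.cong (suc (suc a) ∸_) (ℕ.*-suc 2 k)

[1+a]∸2[1+k]≡a∸2k∸1 : ∀ a k → suc a ∸ 2 *ℕ suc k ≡ a ∸ 2 *ℕ k ∸ 1
[1+a]∸2[1+k]≡a∸2k∸1 a k = begin
  suc a ∸ 2 *ℕ suc k     ≡⟨ ≡.cong (suc a ∸_) (ℕ.*-suc 2 k) ⟩
  a ∸ suc (2 *ℕ k)       ≡⟨ ≡.cong (a ∸_) (ℕ.+-comm 1 (2 *ℕ k)) ⟩
  a ∸ (2 *ℕ k +ℕ 1)      ≡⟨ ℕ.∸-+-assoc a (2 *ℕ k) 1 ⟨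
  a ∸ 2 *ℕ k ∸ 1         ∎
  where open ≡.≡-Reasoning

m⊓n<k⇒m<k⊎n<k : ∀ {m n k} → m ⊓ n < k → m < k ⊎ n < k
m⊓n<k⇒m<k⊎n<k {m} {n} {k} m⊓n<k =
  [ (λ e → inj₁ (≡.subst (_< k) e m⊓n<k)) , (λ e → inj₂ (≡.subst (_< k) e m⊓n<k)) ]′ (ℕ.⊓-sel m n)

module IntegerCoefficientSolver {c ℓ} (R : CommutativeRing c ℓ) where
  open CommutativeRing R
  open import Algebra.Properties.Ring ring using (-0#≈0#; -‿involutive; -1*x≈-x)
  open import Algebra.Properties.AbelianGroup +-abelianGroup using (xyx⁻¹≈y; ⁻¹-∙-comm)
  open import Algebra.Properties.Group +-group using (⁻¹-anti-homo-∙)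
  open import Algebra.Properties.CommutativeSemigroup *-commutativeSemigroup using (interchange)
  open import Algebra.Properties.Semiring.Mult.TCOptimised semiring using (_×_; 1+×; ×-homo-+; ×1-homo-*)
  open import Relation.Binary.Reasoning.Setoid setoid

  -- The optimised multiplication gives 1 × 1# = 1# definitionally, so that
  -- the constant con (+ 1) of the solver denotes 1# on the nose.
  ⟦_⟧ℤ : ℤ → Carrier
  ⟦ + n ⟧ℤ      = n × 1#
  ⟦ -[1+ n ] ⟧ℤ = - (suc n × 1#)

  ⟦-⟧ℤ : ∀ i → ⟦ ℤ.- i ⟧ℤ ≈ - ⟦ i ⟧ℤ
  ⟦-⟧ℤ (+ zero)  = sym -0#≈0#
  ⟦-⟧ℤ (+ suc n) = refl
  ⟦-⟧ℤ -[1+ n ]  = sym (-‿involutive _)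

  ⟦⊖⟧ℤ : ∀ m n → ⟦ m ℤ.⊖ n ⟧ℤ ≈ m × 1# - n × 1#
  ⟦⊖⟧ℤ zero    zero    = sym (-‿inverseʳ 0#)
  ⟦⊖⟧ℤ zero    (suc n) = sym (+-identityˡ _)
  ⟦⊖⟧ℤ (suc m) zero    = sym (trans (+-congˡ -0#≈0#) (+-identityʳ _))
  ⟦⊖⟧ℤ (suc m) (suc n) = begin
    ⟦ suc m ℤ.⊖ suc n ⟧ℤ           ≡⟨ ≡.cong ⟦_⟧ℤ (ℤ.[1+m]⊖[1+n]≡m⊖n m n) ⟩
    ⟦ m ℤ.⊖ n ⟧ℤ                   ≈⟨ ⟦⊖⟧ℤ m n ⟩
    m × 1# - n × 1#                ≈⟨ 1+x-[1+y]≈x-y (m × 1#) (n × 1#) ⟨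
    (1# + m × 1#) - (1# + n × 1#)  ≈⟨ +-cong (1+× m 1#) (-‿cong (1+× n 1#)) ⟨
    suc m × 1# - suc n × 1#        ∎
    where
    1+x-[1+y]≈x-y : ∀ a b → (1# + a) - (1# + b) ≈ a - b
    1+x-[1+y]≈x-y a b = begin
      (1# + a) - (1# + b)    ≈⟨ +-congˡ (⁻¹-anti-homo-∙ 1# b) ⟩
      (1# + a) + (- b - 1#)  ≈⟨ +-assoc (1# + a) (- b) (- 1#) ⟨
      (1# + a) - b - 1#      ≈⟨ +-congʳ (+-assoc 1# a (- b)) ⟩
      1# + (a - b) - 1#      ≈⟨ xyx⁻¹≈y 1# (a - b) ⟩
      a - b                  ∎

  ⟦+⟧ℤ : ∀ i j → ⟦ i ℤ.+ j ⟧ℤ ≈ ⟦ i ⟧ℤ + ⟦ j ⟧ℤ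
  ⟦+⟧ℤ -[1+ m ] -[1+ n ] = begin
    - (suc (suc (m +ℕ n)) × 1#)     ≡⟨ ≡.cong (λ k → - (k × 1#)) (ℕ.+-suc (suc m) n) ⟨
    - ((suc m +ℕ suc n) × 1#)       ≈⟨ -‿cong (×-homo-+ 1# (suc m) (suc n)) ⟩
    - (suc m × 1# + suc n × 1#)     ≈⟨ ⁻¹-∙-comm _ _ ⟨
    - (suc m × 1#) - (suc n × 1#)   ∎
  ⟦+⟧ℤ -[1+ m ] (+ n)    = trans (⟦⊖⟧ℤ n (suc m)) (+-comm _ _)
  ⟦+⟧ℤ (+ m)    -[1+ n ] = ⟦⊖⟧ℤ m (suc n)
  ⟦+⟧ℤ (+ m)    (+ n)    = ×-homo-+ 1# m n

  ⟦_⟧± : Sign → Carrier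
  ⟦ Sign.+ ⟧± = 1#
  ⟦ Sign.- ⟧± = - 1#

  ⟦*⟧± : ∀ s t → ⟦ s Sign.* t ⟧± ≈ ⟦ s ⟧± * ⟦ t ⟧±
  ⟦*⟧± Sign.+ t      = sym (*-identityˡ _)
  ⟦*⟧± Sign.- Sign.+ = sym (*-identityʳ _)
  ⟦*⟧± Sign.- Sign.- = sym (trans (-1*x≈-x _) (-‿involutive _))

  ⟦◃⟧ℤ : ∀ s n → ⟦ s ℤ.◃ n ⟧ℤ ≈ ⟦ s ⟧± * n × 1#
  ⟦◃⟧ℤ s      zero    = sym (zeroʳ _)
  ⟦◃⟧ℤ Sign.+ (suc n) = sym (*-identityˡ _)
  ⟦◃⟧ℤ Sign.- (suc n) = sym (-1*x≈-x _)

  ⟦⟧ℤ≈sign*abs : ∀ i → ⟦ i ⟧ℤ ≈ ⟦ ℤ.sign i ⟧± * ℤ.∣ i ∣ × 1#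
  ⟦⟧ℤ≈sign*abs i =
    trans (reflexive (≡.cong ⟦_⟧ℤ (≡.sym (ℤ.◃-inverse i)))) (⟦◃⟧ℤ (ℤ.sign i) ℤ.∣ i ∣)

  ⟦*⟧ℤ : ∀ i j → ⟦ i ℤ.* j ⟧ℤ ≈ ⟦ i ⟧ℤ * ⟦ j ⟧ℤ
  ⟦*⟧ℤ i j = begin
    ⟦ i ℤ.* j ⟧ℤ
      ≈⟨ ⟦◃⟧ℤ (ℤ.sign i Sign.* ℤ.sign j) (ℤ.∣ i ∣ *ℕ ℤ.∣ j ∣) ⟩
    ⟦ ℤ.sign i Sign.* ℤ.sign j ⟧± * (ℤ.∣ i ∣ *ℕ ℤ.∣ j ∣) × 1#
      ≈⟨ *-cong (⟦*⟧± (ℤ.sign i) (ℤ.sign j)) (×1-homo-* ℤ.∣ i ∣ ℤ.∣ j ∣) ⟩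
    (⟦ ℤ.sign i ⟧± * ⟦ ℤ.sign j ⟧±) * (ℤ.∣ i ∣ × 1# * ℤ.∣ j ∣ × 1#)
      ≈⟨ interchange _ _ _ _ ⟩
    (⟦ ℤ.sign i ⟧± * ℤ.∣ i ∣ × 1#) * (⟦ ℤ.sign j ⟧± * ℤ.∣ j ∣ × 1#)
      ≈⟨ *-cong (⟦⟧ℤ≈sign*abs i) (⟦⟧ℤ≈sign*abs j) ⟨
    ⟦ i ⟧ℤ * ⟦ j ⟧ℤ                              ∎

  ⟦⟧ℤ-homomorphism : ℤ.+-*-rawRing ACR.-Raw-AlmostCommutative⟶ ACR.fromCommutativeRing R
  ⟦⟧ℤ-homomorphism = record
    { ⟦_⟧    = ⟦_⟧ℤ
    ; +-homo = ⟦+⟧ℤ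
    ; *-homo = ⟦*⟧ℤ
    ; -‿homo = ⟦-⟧ℤ
    ; 0-homo = refl
    ; 1-homo = refl
    }

  ⟦⟧ℤ-≟ : ∀ i j → Maybe (⟦ i ⟧ℤ ≈ ⟦ j ⟧ℤ)
  ⟦⟧ℤ-≟ i j with i ℤ.≟ j
  ... | yes i≡j = just (reflexive (≡.cong ⟦_⟧ℤ i≡j))
  ... | no _    = nothing

  open import Algebra.Solver.Ring ℤ.+-*-rawRing (ACR.fromCommutativeRing R) ⟦⟧ℤ-homomorphism ⟦⟧ℤ-≟ public

module Linearization {c ℓ} (R : CommutativeRing c ℓ) where
  open CommutativeRing R hiding (zero)
  open import Relation.Binary.Reasoning.Setoid setoid
  open IntegerCoefficientSolver R using (Polynomial; con; solve; _:=_; _:+_; _:*_; _:-_)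
  open import Data.Product.Base using (_×_)
  open import Algebra.Properties.CommutativeSemigroup *-commutativeSemigroup using (x∙yz≈y∙xz)

  private
    ιᴿ : ℕ → Carrier
    ιᴿ = ι R

    ffᴿ : Carrier → ℕ → Carrier
    ffᴿ = ff R

    Σᴿ : ℕ → (ℕ → Carrier) → Carrier
    Σᴿ = sumTo R

    :0 :1 : ∀ {k} → Polynomial k
    :0 = con (+ 0)
    :1 = con (+ 1)

  x≈0⇒x*y≈x*z : ∀ {x} y z → x ≈ 0# → x * y ≈ x * z
  x≈0⇒x*y≈x*z y z x≈0 = trans (*-congʳ x≈0) (trans (zeroˡ y) (sym (trans (*-congʳ x≈0) (zeroˡ z))))

  ι-homo-+ : ∀ m n → ιᴿ (m +ℕ n) ≈ ιᴿ m + ιᴿ n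
  ι-homo-+ zero    n = sym (+-identityˡ _)
  ι-homo-+ (suc m) n = trans (+-congˡ (ι-homo-+ m n)) (sym (+-assoc _ _ _))

  ι-homo-* : ∀ m n → ιᴿ (m *ℕ n) ≈ ιᴿ m * ιᴿ n
  ι-homo-* zero    n = sym (zeroˡ _)
  ι-homo-* (suc m) n = begin
    ιᴿ (n +ℕ m *ℕ n)        ≈⟨ ι-homo-+ n (m *ℕ n) ⟩
    ιᴿ n + ιᴿ (m *ℕ n)      ≈⟨ +-congˡ (ι-homo-* m n) ⟩
    ιᴿ n + ιᴿ m * ιᴿ n      ≈⟨ +-congʳ (*-identityˡ _) ⟨
    1# * ιᴿ n + ιᴿ m * ιᴿ n ≈⟨ distribʳ _ _ _ ⟨
    (1# + ιᴿ m) * ιᴿ n      ∎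

  ι-homo-∸ : ∀ {m n} → n ≤ m → ιᴿ (m ∸ n) ≈ ιᴿ m - ιᴿ n
  ι-homo-∸ {m} {n} n≤m = begin
    ιᴿ (m ∸ n)                ≈⟨ solve 2 (λ a b → a := a :+ b :- b) refl (ιᴿ (m ∸ n)) (ιᴿ n) ⟩
    ιᴿ (m ∸ n) + ιᴿ n - ιᴿ n  ≈⟨ +-congʳ (ι-homo-+ (m ∸ n) n) ⟨
    ιᴿ (m ∸ n +ℕ n) - ιᴿ n    ≡⟨ ≡.cong (λ k → ιᴿ k - ιᴿ n) (ℕ.m∸n+n≡m n≤m) ⟩
    ιᴿ m - ιᴿ n               ∎

  ff-cong : ∀ {a b} k → a ≈ b → ffᴿ a k ≈ ffᴿ b k
  ff-cong zero    a≈b = refl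
  ff-cong (suc k) a≈b = *-cong (ff-cong k a≈b) (+-congʳ a≈b)

  ff-1+ : ∀ a k → ffᴿ (1# + a) (suc k) ≈ (1# + a) * ffᴿ a k
  ff-1+ a zero    = solve 1 (λ a → :1 :* ((:1 :+ a) :- :0) := (:1 :+ a) :* :1) refl a
  ff-1+ a (suc k) = begin
    ffᴿ (1# + a) (suc k) * ((1# + a) - (1# + ιᴿ k))   ≈⟨ *-congʳ (ff-1+ a k) ⟩
    (1# + a) * ffᴿ a k * ((1# + a) - (1# + ιᴿ k))
      ≈⟨ solve 3 (λ a f i → (:1 :+ a) :* f :* ((:1 :+ a) :- (:1 :+ i)) := (:1 :+ a) :* (f :* (a :- i)))
           refl a (ffᴿ a k) (ιᴿ k) ⟩
    (1# + a) * (ffᴿ a k * (a - ιᴿ k))                  ∎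

  ff-ι-vanish : ∀ {n k} → n < k → ffᴿ (ιᴿ n) k ≈ 0#
  ff-ι-vanish {n} {suc k} n<1+k with ℕ.m<1+n⇒m<n∨m≡n n<1+k
  ... | inj₁ n<k    = trans (*-congʳ (ff-ι-vanish n<k)) (zeroˡ _)
  ... | inj₂ ≡.refl = trans (*-congˡ (-‿inverseʳ _)) (zeroʳ _)

  ι[nCk*k!]≈ff : ∀ n k → ιᴿ ((n C k) *ℕ k !) ≈ ffᴿ (ιᴿ n) k
  ι[nCk*k!]≈ff n       zero    = +-identityʳ 1#
  ι[nCk*k!]≈ff zero    (suc k) = sym (ff-ι-vanish {0} {suc k} (s≤s z≤n))
  ι[nCk*k!]≈ff (suc n) (suc k) = begin
    ιᴿ ((suc n C suc k) *ℕ suc k !)   ≡⟨ ≡.cong ιᴿ reassociate ⟩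
    ιᴿ (suc n *ℕ ((n C k) *ℕ k !))    ≈⟨ ι-homo-* (suc n) ((n C k) *ℕ k !) ⟩
    (1# + ιᴿ n) * ιᴿ ((n C k) *ℕ k !) ≈⟨ *-congˡ (ι[nCk*k!]≈ff n k) ⟩
    (1# + ιᴿ n) * ffᴿ (ιᴿ n) k      ≈⟨ ff-1+ (ιᴿ n) k ⟨
    ffᴿ (ιᴿ (suc n)) (suc k)        ∎
    where
    shuffle : ∀ c k f → c *ℕ (suc k *ℕ f) ≡ suc k *ℕ c *ℕ f
    shuffle = solve-∀
    reassociate : (suc n C suc k) *ℕ suc k ! ≡ suc n *ℕ ((n C k) *ℕ k !)
    reassociate = ≡.trans (shuffle (suc n C suc k) k (k !))
                    (≡.trans (≡.cong (_*ℕ k !) (≡.sym ([1+n]*nCk≡[1+k]*[1+n]C[1+k] n k)))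
                             (ℕ.*-assoc (suc n) (n C k) (k !)))

  sumTo-cong : ∀ K {f g} → (∀ k → f k ≈ g k) → Σᴿ K f ≈ Σᴿ K g
  sumTo-cong zero    f≈g = f≈g zero
  sumTo-cong (suc K) f≈g = +-cong (sumTo-cong K f≈g) (f≈g (suc K))

  sumTo-head : ∀ K f → Σᴿ (suc K) f ≈ f zero + Σᴿ K (f ∘ suc)
  sumTo-head zero    f = refl
  sumTo-head (suc K) f = trans (+-congʳ (sumTo-head K f)) (+-assoc _ _ _)

  sumTo-+ : ∀ K f g → Σᴿ K (λ k → f k + g k) ≈ Σᴿ K f + Σᴿ K g
  sumTo-+ zero    f g = refl
  sumTo-+ (suc K) f g = trans (+-congʳ (sumTo-+ K f g))
    (solve 4 (λ a b c d → (a :+ b) :+ (c :+ d) := (a :+ c) :+ (b :+ d)) refl _ _ _ _)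

  sumTo-- : ∀ K f g → Σᴿ K (λ k → f k - g k) ≈ Σᴿ K f - Σᴿ K g
  sumTo-- zero    f g = refl
  sumTo-- (suc K) f g = trans (+-congʳ (sumTo-- K f g))
    (solve 4 (λ a b c d → (a :- b) :+ (c :- d) := (a :+ c) :- (b :+ d)) refl _ _ _ _)

  sumTo-distribˡ : ∀ K a f → a * Σᴿ K f ≈ Σᴿ K (λ k → a * f k)
  sumTo-distribˡ zero    a f = refl
  sumTo-distribˡ (suc K) a f = trans (distribˡ _ _ _) (+-congʳ (sumTo-distribˡ K a f))

  sumTo-trim : ∀ {J} K f → J ≤ K → (∀ k → J < k → f k ≈ 0#) → Σᴿ K f ≈ Σᴿ J f
  sumTo-trim zero    f z≤n   f≈0 = refl
  sumTo-trim (suc K) f J≤1+K f≈0 with ℕ.m≤n⇒m<n∨m≡n J≤1+K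
  ... | inj₂ ≡.refl = refl
  ... | inj₁ J<1+K  = trans (+-cong (sumTo-trim K f (ℕ.≤-pred J<1+K) f≈0) (f≈0 (suc K) J<1+K)) (+-identityʳ _)

  -- The coefficient recurrence in disguise: M, N, J stand for m, n, j, a for 2r, C₀, C₁, C₂ for
  -- C(m+1,j), C(m+1,j+1), C(m,j), and G, F, H for (n)_j, (B)_j, (B+1)_j.
  recurrence-identity : ∀ M N J a C₀ C₁ C₂ G F H →
    let B = a + M + N - J
        L = 1# + M + N - (J + J)
    in (1# + M) * C₂ ≈ (1# + J) * C₁ →
       (1# + J) * C₁ + J * C₀ ≈ (1# + M) * C₀ →
       H * ((1# + B) - J) ≈ (1# + B) * F →
       (C₀ + C₁) * (G * (N - J)) * ((1# + B) * F)
         ≈ C₁ * (G * (N - J)) * (F * (B - J)) + C₀ * G * H * (L * (L + a))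
           - (1# + M) * (1# + M + a) * (C₂ * G * F)
  recurrence-identity M N J a C₀ C₁ C₂ G F H r₁ r₂ r₃ = begin
    (C₀ + C₁) * (G * (N - J)) * ((1# + B) * F)
      ≈⟨ solve 8 (λ M N J a C₀ C₁ G F →
           let B = a :+ M :+ N :- J
               L = :1 :+ M :+ N :- (J :+ J)
           in (C₀ :+ C₁) :* (G :* (N :- J)) :* ((:1 :+ B) :* F)
              := C₁ :* (G :* (N :- J)) :* (F :* (B :- J)) :+ C₀ :* G :* L :* ((:1 :+ B) :* F)
                 :- (:1 :+ M :+ a) :* G :* F :* ((:1 :+ J) :* C₁)
                 :+ G :* F :* (:1 :+ B) :* ((:1 :+ J) :* C₁ :+ J :* C₀ :- (:1 :+ M) :* C₀))
           refl M N J a C₀ C₁ G F ⟩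
    X + W * ((1# + J) * C₁ + J * C₀ - (1# + M) * C₀)
      ≈⟨ +-congˡ (*-congˡ (trans (+-congʳ r₂) (-‿inverseʳ _))) ⟩
    X + W * 0#
      ≈⟨ trans (+-congˡ (zeroʳ W)) (+-identityʳ X) ⟩
    X
      ≈⟨ +-cong (+-congˡ (*-congˡ r₃)) (-‿cong (*-congˡ r₁)) ⟨
    C₁ * (G * (N - J)) * (F * (B - J)) + C₀ * G * L * (H * ((1# + B) - J))
      - (1# + M + a) * G * F * ((1# + M) * C₂)
      ≈⟨ solve 10 (λ M N J a C₀ C₁ C₂ G F H →
           let B = a :+ M :+ N :- J
               L = :1 :+ M :+ N :- (J :+ J)
           in C₁ :* (G :* (N :- J)) :* (F :* (B :- J)) :+ C₀ :* G :* L :* (H :* ((:1 :+ B) :- J))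
                :- (:1 :+ M :+ a) :* G :* F :* ((:1 :+ M) :* C₂)
              := C₁ :* (G :* (N :- J)) :* (F :* (B :- J)) :+ C₀ :* G :* H :* (L :* (L :+ a))
                 :- (:1 :+ M) :* (:1 :+ M :+ a) :* (C₂ :* G :* F))
           refl M N J a C₀ C₁ C₂ G F H ⟩
    C₁ * (G * (N - J)) * (F * (B - J)) + C₀ * G * H * (L * (L + a))
      - (1# + M) * (1# + M + a) * (C₂ * G * F) ∎
    where
    B = a + M + N - J
    L = 1# + M + N - (J + J)
    W = G * F * (1# + B)
    X = C₁ * (G * (N - J)) * (F * (B - J)) + C₀ * G * L * ((1# + B) * F) - (1# + M + a) * G * F * ((1# + J) * C₁)

  ι-pascal : ∀ m j → ιᴿ (suc m C suc j) ≈ ιᴿ (m C j) + ιᴿ (m C suc j)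
  ι-pascal m j = trans (reflexive (≡.cong ιᴿ (≡.sym (nCk+nC[k+1]≡[n+1]C[k+1] m j)))) (ι-homo-+ (m C j) (m C suc j))

  ι-absorption : ∀ m j → (1# + ιᴿ m) * ιᴿ (m C j) ≈ (1# + ιᴿ j) * ιᴿ (suc m C suc j)
  ι-absorption m j = begin
    (1# + ιᴿ m) * ιᴿ (m C j)            ≈⟨ ι-homo-* (suc m) (m C j) ⟨
    ιᴿ (suc m *ℕ (m C j))               ≡⟨ ≡.cong ιᴿ ([1+n]*nCk≡[1+k]*[1+n]C[1+k] m j) ⟩
    ιᴿ (suc j *ℕ (suc m C suc j))       ≈⟨ ι-homo-* (suc j) (suc m C suc j) ⟩
    (1# + ιᴿ j) * ιᴿ (suc m C suc j)    ∎

  ι-absorption-+ : ∀ m j → (1# + ιᴿ j) * ιᴿ (m C suc j) + ιᴿ j * ιᴿ (m C j) ≈ ιᴿ m * ιᴿ (m C j)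
  ι-absorption-+ m j = begin
    (1# + ιᴿ j) * ιᴿ (m C suc j) + ιᴿ j * ιᴿ (m C j)
      ≈⟨ +-cong (ι-homo-* (suc j) (m C suc j)) (ι-homo-* j (m C j)) ⟨
    ιᴿ (suc j *ℕ (m C suc j)) + ιᴿ (j *ℕ (m C j))
      ≈⟨ ι-homo-+ (suc j *ℕ (m C suc j)) (j *ℕ (m C j)) ⟨
    ιᴿ (suc j *ℕ (m C suc j) +ℕ j *ℕ (m C j))
      ≡⟨ ≡.cong ιᴿ ([1+k]*nC[1+k]+k*nCk≡n*nCk m j) ⟩
    ιᴿ (m *ℕ (m C j))
      ≈⟨ ι-homo-* m (m C j) ⟩
    ιᴿ m * ιᴿ (m C j) ∎

  module _ (r x : Carrier) (n : ℕ) where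

    Dₓ : ℕ → Carrier
    Dₓ j = D R r j x

    γ : ℕ → Carrier
    γ j = ιᴿ j * (ιᴿ j + (r + r))

    x*Dₓ : ∀ j → x * Dₓ j ≈ Dₓ (suc j) + γ j * Dₓ (j ∸ 1)
    x*Dₓ zero    = solve 2 (λ x s → x :* :1 := (x :* :1 :- :0 :* :0) :+ :0 :* (:0 :+ s) :* :1) refl x (r + r)
    x*Dₓ (suc j) = solve 3 (λ a g d → a := (a :- g :* d) :+ g :* d) refl (x * Dₓ (suc j)) (γ (suc j)) (Dₓ j)

    coeff : ℕ → ℕ → Carrier
    coeff m k = ιᴿ (m C k) * ffᴿ (ιᴿ n) k * ffᴿ (r + r + ιᴿ m + ιᴿ n - ιᴿ k) k

    -- Truncated subtraction only matters where 2k > m + n, and there coeff m k vanishes.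
    index : ℕ → ℕ → ℕ
    index m k = m +ℕ n ∸ 2 *ℕ k

    term : ℕ → ℕ → Carrier
    term m k = coeff m k * Dₓ (index m k)

    coeff-vanish : ∀ {m k} → m < k ⊎ n < k → coeff m k ≈ 0#
    coeff-vanish (inj₁ m<k) =
      trans (*-congʳ (*-congʳ (reflexive (≡.cong ιᴿ (k>n⇒nCk≡0 m<k))))) (trans (*-congʳ (zeroˡ _)) (zeroˡ _))
    coeff-vanish (inj₂ n<k) =
      trans (*-congʳ (*-congˡ (ff-ι-vanish n<k))) (trans (*-congʳ (zeroʳ _)) (zeroˡ _))

    term-vanish : ∀ {m k} → m < k ⊎ n < k → term m k ≈ 0#
    term-vanish out = trans (*-congʳ (coeff-vanish out)) (zeroˡ _)

    in-range? : ∀ m k → (k ≤ m × k ≤ n) ⊎ (m < k ⊎ n < k)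
    in-range? m k with k ℕ.≤? m | k ℕ.≤? n
    ... | yes k≤m | yes k≤n = inj₁ (k≤m , k≤n)
    ... | no  k≰m | _       = inj₂ (inj₁ (ℕ.≰⇒> k≰m))
    ... | yes _   | no  k≰n = inj₂ (inj₂ (ℕ.≰⇒> k≰n))

    ι-index : ∀ {m k} → k ≤ m → k ≤ n → ιᴿ (index m k) ≈ ιᴿ m + ιᴿ n - (ιᴿ k + ιᴿ k)
    ι-index {m} {k} k≤m k≤n = begin
      ιᴿ (m +ℕ n ∸ 2 *ℕ k)                ≈⟨ ι-homo-∸ (k≤m⇒k≤n⇒2k≤m+n k≤m k≤n) ⟩
      ιᴿ (m +ℕ n) - ιᴿ (2 *ℕ k)           ≈⟨ +-cong (ι-homo-+ m n) (-‿cong (ι-homo-+ k (k +ℕ 0))) ⟩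
      ιᴿ m + ιᴿ n - (ιᴿ k + ιᴿ (k +ℕ 0))  ≡⟨ ≡.cong (λ i → ιᴿ m + ιᴿ n - (ιᴿ k + ιᴿ i)) (ℕ.+-identityʳ k) ⟩
      ιᴿ m + ιᴿ n - (ιᴿ k + ιᴿ k)         ∎

    coeff-recurrence-in-range : ∀ {m j} → j ≤ suc m → j ≤ n →
      coeff (suc (suc m)) (suc j)
        ≈ coeff (suc m) (suc j) + coeff (suc m) j * γ (index (suc m) j) - γ (suc m) * coeff m j
    coeff-recurrence-in-range {m} {j} j≤1+m j≤n = begin
      coeff (suc (suc m)) (suc j)
        ≈⟨ *-cong (*-congʳ (ι-pascal (suc m) j)) (trans (ff-cong (suc j) base₂) (ff-1+ B j)) ⟩
      (C₀ + C₁) * (G * (N - J)) * ((1# + B) * F)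
        ≈⟨ recurrence-identity M N J a C₀ C₁ C₂ G F H
             (ι-absorption m j) (ι-absorption-+ (suc m) j) (ff-1+ B j) ⟩
      C₁ * (G * (N - J)) * (F * (B - J)) + C₀ * G * H * (L * (L + a)) - (1# + M) * (1# + M + a) * (C₂ * G * F)
        ≈⟨ +-congʳ (+-cong (*-congˡ (ff-cong (suc j) base₁))
                           (*-cong (*-congˡ (ff-cong j base₀)) (*-cong ι-L (+-congʳ ι-L)))) ⟨
      coeff (suc m) (suc j) + coeff (suc m) j * γ (index (suc m) j) - γ (suc m) * coeff m j ∎
      where
      a = r + r
      M = ιᴿ m
      N = ιᴿ n
      J = ιᴿ j
      B = a + M + N - J
      L = 1# + M + N - (J + J)
      C₀ = ιᴿ (suc m C j)
      C₁ = ιᴿ (suc m C suc j)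
      C₂ = ιᴿ (m C j)
      G = ffᴿ N j
      F = ffᴿ B j
      H = ffᴿ (1# + B) j
      base₀ : a + (1# + M) + N - J ≈ 1# + B
      base₀ = solve 4 (λ a M N J → a :+ (:1 :+ M) :+ N :- J := :1 :+ (a :+ M :+ N :- J)) refl a M N J
      base₁ : a + (1# + M) + N - (1# + J) ≈ B
      base₁ = solve 4 (λ a M N J → a :+ (:1 :+ M) :+ N :- (:1 :+ J) := a :+ M :+ N :- J) refl a M N J
      base₂ : a + (1# + (1# + M)) + N - (1# + J) ≈ 1# + B
      base₂ = solve 4 (λ a M N J → a :+ (:1 :+ (:1 :+ M)) :+ N :- (:1 :+ J) := :1 :+ (a :+ M :+ N :- J))
                refl a M N J
      ι-L : ιᴿ (index (suc m) j) ≈ L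
      ι-L = ι-index j≤1+m j≤n

    coeff-recurrence : ∀ m j →
      coeff (suc (suc m)) (suc j)
        ≈ coeff (suc m) (suc j) + coeff (suc m) j * γ (index (suc m) j) - γ (suc m) * coeff m j
    coeff-recurrence m j with in-range? (suc m) j
    ... | inj₁ (j≤1+m , j≤n) = coeff-recurrence-in-range j≤1+m j≤n
    ... | inj₂ out = begin
      coeff (suc (suc m)) (suc j)
        ≈⟨ coeff-vanish (Sum.map s≤s ℕ.m<n⇒m<1+n out) ⟩
      0#
        ≈⟨ solve 2 (λ q g → :0 := :0 :+ :0 :* q :- g :* :0) refl (γ (index (suc m) j)) (γ (suc m)) ⟩
      0# + 0# * γ (index (suc m) j) - γ (suc m) * 0#
        ≈⟨ +-cong (+-cong (coeff-vanish (Sum.map ℕ.m<n⇒m<1+n ℕ.m<n⇒m<1+n out)) (*-congʳ (coeff-vanish out)))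
                  (-‿cong (*-congˡ (coeff-vanish (Sum.map (ℕ.<-trans (ℕ.n<1+n m)) id out)))) ⟨
      coeff (suc m) (suc j) + coeff (suc m) j * γ (index (suc m) j) - γ (suc m) * coeff m j ∎

    raised lowered : ℕ → ℕ → Carrier
    raised  m k = coeff m k * Dₓ (suc (index m k))
    lowered m k = coeff m k * γ (index m k) * Dₓ (index m k ∸ 1)

    x*term : ∀ m k → x * term m k ≈ raised m k + lowered m k
    x*term m k = begin
      x * (coeff m k * Dₓ i)                                      ≈⟨ x∙yz≈y∙xz x (coeff m k) (Dₓ i) ⟩
      coeff m k * (x * Dₓ i)                                      ≈⟨ *-congˡ (x*Dₓ i) ⟩
      coeff m k * (Dₓ (suc i) + γ i * Dₓ (i ∸ 1))                 ≈⟨ distribˡ _ _ _ ⟩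
      coeff m k * Dₓ (suc i) + coeff m k * (γ i * Dₓ (i ∸ 1))     ≈⟨ +-congˡ (*-assoc _ _ _) ⟨
      raised m k + lowered m k                                    ∎
      where i = index m k

    lowered-vanish : ∀ {m k} → m < k → lowered m k ≈ 0#
    lowered-vanish m<k = trans (*-congʳ (trans (*-congʳ (coeff-vanish (inj₁ m<k))) (zeroˡ _))) (zeroˡ _)

    -- The index identity behind the first summand fails only where its coefficient vanishes.
    raised-shift : ∀ m j →
      coeff (suc m) (suc j) * Dₓ (index (suc (suc m)) (suc j)) ≈ raised (suc m) (suc j)
    raised-shift m j with in-range? (suc m) (suc j)
    ... | inj₁ (1+j≤1+m , 1+j≤n) =
      *-congˡ (reflexive (≡.cong Dₓ (ℕ.+-∸-assoc 1 (k≤m⇒k≤n⇒2k≤m+n 1+j≤1+m 1+j≤n))))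
    ... | inj₂ out = x≈0⇒x*y≈x*z _ _ (coeff-vanish out)

    term-recurrence : ∀ m j →
      term (suc (suc m)) (suc j) ≈ raised (suc m) (suc j) + lowered (suc m) j - γ (suc m) * term m j
    term-recurrence m j = begin
      coeff (suc (suc m)) (suc j) * Dₓ I
        ≈⟨ *-congʳ (coeff-recurrence m j) ⟩
      (coeff (suc m) (suc j) + coeff (suc m) j * γ (index (suc m) j) - γ (suc m) * coeff m j) * Dₓ I
        ≈⟨ solve 6 (λ c₁ c₀ q g c d →
                      (c₁ :+ c₀ :* q :- g :* c) :* d := c₁ :* d :+ c₀ :* q :* d :- g :* (c :* d))
             refl (coeff (suc m) (suc j)) (coeff (suc m) j) (γ (index (suc m) j)) (γ (suc m)) (coeff m j) (Dₓ I) ⟩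
      coeff (suc m) (suc j) * Dₓ I + coeff (suc m) j * γ (index (suc m) j) * Dₓ I - γ (suc m) * (coeff m j * Dₓ I)
        ≈⟨ +-cong (+-cong (raised-shift m j)
                          (*-congˡ (reflexive (≡.cong Dₓ ([1+a]∸2[1+k]≡a∸2k∸1 (suc m +ℕ n) j)))))
                  (-‿cong (*-congˡ (*-congˡ (reflexive (≡.cong Dₓ ([2+a]∸2[1+k]≡a∸2k (m +ℕ n) j)))))) ⟩
      raised (suc m) (suc j) + lowered (suc m) j - γ (suc m) * term m j ∎
      where I = index (suc (suc m)) (suc j)

    -- Allowing any length K ≥ m lets the expansions of D m and D (1 + m) be compared termwise.
    Expansion : ℕ → Set ℓ
    Expansion m = ∀ K → m ≤ K → Dₓ m * Dₓ n ≈ Σᴿ K (term m)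

    expansion-0 : Expansion 0
    expansion-0 K _ = begin
      1# * Dₓ n     ≈⟨ solve 1 (λ d → :1 :* d := (:1 :+ :0) :* :1 :* :1 :* d) refl (Dₓ n) ⟩
      term 0 0      ≈⟨ sumTo-trim K (term 0) z≤n (λ k 0<k → term-vanish (inj₁ 0<k)) ⟨
      Σᴿ K (term 0) ∎

    expansion-1 : Expansion 1
    expansion-1 K 1≤K = begin
      (x * 1# - 0# * 0#) * Dₓ n      ≈⟨ solve 2 (λ x d → (x :* :1 :- :0 :* :0) :* d := x :* d) refl x (Dₓ n) ⟩
      x * Dₓ n                       ≈⟨ x*Dₓ n ⟩
      Dₓ (suc n) + γ n * Dₓ (n ∸ 1)  ≈⟨ solve 4 (λ N s d₁ d₀ →
                                          d₁ :+ N :* (N :+ s) :* d₀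
                                          := (:1 :+ :0) :* :1 :* :1 :* d₁
                                             :+ (:1 :+ :0) :* (:1 :* (N :- :0))
                                                :* (:1 :* (s :+ (:1 :+ :0) :+ N :- (:1 :+ :0) :- :0)) :* d₀)
                                          refl (ιᴿ n) (r + r) (Dₓ (suc n)) (Dₓ (n ∸ 1)) ⟩
      term 1 0 + term 1 1            ≈⟨ sumTo-trim K (term 1) 1≤K (λ k 1<k → term-vanish (inj₁ 1<k)) ⟨
      Σᴿ K (term 1)                  ∎

    expansion-2+ : ∀ m → Expansion m → Expansion (suc m) → Expansion (suc (suc m))
    expansion-2+ m expandₘ expand₁₊ₘ (suc K) (s≤s 1+m≤K) = begin
      (x * Dₓ (suc m) - γ (suc m) * Dₓ m) * Dₓ n
        ≈⟨ solve 5 (λ x d₁ g d₀ dₙ →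
                      (x :* d₁ :- g :* d₀) :* dₙ := x :* (d₁ :* dₙ) :- g :* (d₀ :* dₙ))
             refl x (Dₓ (suc m)) g (Dₓ m) (Dₓ n) ⟩
      x * (Dₓ (suc m) * Dₓ n) - g * (Dₓ m * Dₓ n)
        ≈⟨ +-cong (*-congˡ (expand₁₊ₘ (suc K) (ℕ.m≤n⇒m≤1+n 1+m≤K)))
                  (-‿cong (*-congˡ (expandₘ (suc K) (ℕ.m<n⇒m≤1+n 1+m≤K)))) ⟩
      x * Σᴿ (suc K) (term (suc m)) - g * Σᴿ (suc K) (term m)
        ≈⟨ +-cong (trans (sumTo-distribˡ (suc K) x (term (suc m)))
                         (trans (sumTo-cong (suc K) (x*term (suc m))) (sumTo-+ (suc K) up down)))
                  (-‿cong (sumTo-distribˡ (suc K) g (term m))) ⟩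
      Σᴿ (suc K) up + Σᴿ (suc K) down - Σᴿ (suc K) back
        ≈⟨ +-cong (+-cong (sumTo-head K up) (sumTo-trim (suc K) down (ℕ.n≤1+n K) (λ k → lowered-vanish ∘ 1+m<)))
                  (-‿cong (sumTo-trim (suc K) back (ℕ.n≤1+n K) back-vanish)) ⟩
      up 0 + Σᴿ K (up ∘ suc) + Σᴿ K down - Σᴿ K back
        ≈⟨ solve 4 (λ a₀ a b c → a₀ :+ a :+ b :- c := a₀ :+ (a :+ b :- c))
             refl (up 0) (Σᴿ K (up ∘ suc)) (Σᴿ K down) (Σᴿ K back) ⟩
      up 0 + (Σᴿ K (up ∘ suc) + Σᴿ K down - Σᴿ K back)
        ≈⟨ +-congˡ (trans (sumTo-- K (λ j → up (suc j) + down j) back) (+-congʳ (sumTo-+ K (up ∘ suc) down))) ⟨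
      up 0 + Σᴿ K (λ j → up (suc j) + down j - back j)
        ≈⟨ +-congˡ (sumTo-cong K (term-recurrence m)) ⟨
      term (suc (suc m)) 0 + Σᴿ K (term (suc (suc m)) ∘ suc)
        ≈⟨ sumTo-head K (term (suc (suc m))) ⟨
      Σᴿ (suc K) (term (suc (suc m))) ∎
      where
      g = γ (suc m)
      up down back : ℕ → Carrier
      up   = raised (suc m)
      down = lowered (suc m)
      back k = g * term m k
      1+m< : ∀ {k} → K < k → suc m < k
      1+m< = ℕ.≤-<-trans 1+m≤K
      back-vanish : ∀ k → K < k → back k ≈ 0#
      back-vanish k K<k = trans (*-congˡ (term-vanish (inj₁ (ℕ.<-trans (ℕ.n<1+n m) (1+m< K<k))))) (zeroʳ _)

    expansions : ∀ m → Expansion m × Expansion (suc m)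
    expansions zero    = expansion-0 , expansion-1
    expansions (suc m) =
      let expandₘ , expand₁₊ₘ = expansions m in expand₁₊ₘ , expansion-2+ m expandₘ expand₁₊ₘ

    product-expansion : ∀ m → Dₓ m * Dₓ n ≈ Σᴿ (m ⊓ n) (term m)
    product-expansion m = trans (proj₁ (expansions m) m ℕ.≤-refl)
      (sumTo-trim m (term m) (ℕ.m⊓n≤m m n) (λ k m⊓n<k → term-vanish (m⊓n<k⇒m<k⊎n<k m⊓n<k)))

    coeff≈binomial-form : ∀ m k →
      coeff m k ≈ ιᴿ ((m C k) *ℕ (n C k) *ℕ (k !)) * ffᴿ (r + r + ιᴿ m + ιᴿ n - ιᴿ k) k
    coeff≈binomial-form m k = *-congʳ (begin
      ιᴿ (m C k) * ffᴿ (ιᴿ n) k            ≈⟨ *-congˡ (ι[nCk*k!]≈ff n k) ⟨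
      ιᴿ (m C k) * ιᴿ ((n C k) *ℕ k !)     ≈⟨ ι-homo-* (m C k) ((n C k) *ℕ k !) ⟨
      ιᴿ ((m C k) *ℕ ((n C k) *ℕ k !))     ≡⟨ ≡.cong ιᴿ (ℕ.*-assoc (m C k) (n C k) (k !)) ⟨
      ιᴿ ((m C k) *ℕ (n C k) *ℕ (k !))     ∎)

theorem3p7 : ∀ {c ℓ} (R : CommutativeRing c ℓ) (r x : CommutativeRing.Carrier R) (m n : ℕ) →
    let open CommutativeRing R in
    D R r m x * D R r n x
      ≈ sumTo R (m ⊓ n) (λ k →
          (ι R ((m C k) *ℕ (n C k) *ℕ (k !))
            * ff R (r + r + ι R m + ι R n - ι R k) k)
            * D R r ((m +ℕ n) ∸ (2 *ℕ k)) x)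
theorem3p7 R r x m n =
  trans (product-expansion r x n m) (sumTo-cong (m ⊓ n) (λ k → *-congʳ (coeff≈binomial-form r x n m k)))
  where
  open CommutativeRing R
  open Linearization R
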